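{- (i) $\mathrm{BSML}$ is bicomplete for $\{(\mathcal{P},\mathcal{Q}) \mid \mathcal{P},\mathcal{Q}$ are convex, union closed, and invariant under bounded bisimulation, and $\mathcal{P},\mathcal{Q}$ are ground-incompatible$\}$. (ii) $\mathrm{BSMLI}$ is bicomplete for $\{(\mathcal{P},\mathcal{Q}) \mid \mathcal{P},\mathcal{Q}$ are invariant under bounded bisimulation, and $\mathcal{P},\mathcal{Q}$ are ground-incompatible$\}$. (iii) Each of $\mathrm{BSML}$ and $\mathrm{BSMLI}$ is bicomplete modulo expressive power for ground-incompatible pairs.
   Context: $\mathrm{BSML}$: $\phi ::= p \mid \bot \mid \neg\phi \mid \phi\wedge\phi \mid \phi\vee\phi \mid \Diamond\phi \mid \mathrm{NE}$; $\mathrm{BSMLI}$ adds global disjunction $\veebar$. Semantics on Kripke models $M=(W,R,V)$ and teams $s\subseteq W$ via support $s\models\phi$ and anti-support $s\models^-\phi$: $p$ supported iff all worlds of $s$ satisfy $p$, anti-supported iff none do; $s\models\bot$ iff $s=\emptyset$, $\bot$ always anti-supported; $s\models\mathrm{NE}$ iff $s\ne\emptyset$, $s\models^-\mathrm{NE}$ iff $s=\emptyset$; $s\models\neg\phi$ iff $s\models^-\phi$ and vice versa; $\wedge$ supported iff both conjuncts are, anti-supported iff $s=t\cup u$ with $t\models^-\phi,u\models^-\psi$; $\vee$ supported iff $s=t\cup u$ with $t\models\phi,u\models\psi$, anti-supported iff both disjuncts are; $s\models\phi\veebar\psi$ iff $s\models\phi$ or $s\models\psi$, anti-supported iff both are;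 $s\models\Diamond\phi$ iff each $w\in s$ has a nonempty $t\subseteq R[w]$ with $t\models\phi$; $s\models^-\Diamond\phi$ iff $R[w]\models^-\phi$ for all $w\in s$. A (team) property over finite $\mathsf{X}$ is a class of pairs $(M,s)$ with $M$ a model over $\mathsf{X}$; $\|\phi\|_\mathsf{X}$ is the property of all $(M,s)$ with $M,s\models\phi$. Properties $\mathcal{P},\mathcal{Q}$ are ground-incompatible if no pointed world $(M,w)$ has $w\in s$ for some $(M,s)\in\mathcal{P}$ and $w\in t$ for some $(M,t)\in\mathcal{Q}$. Convexity, union closure, invariance under bounded bisimulation are the usual team-semantic notions (invariance under $\mathsf{X},k$-team-bisimulation for some $k$). A logic $L$ is bicomplete for a class $\mathscr{P}$ of pairs of properties if, for every finite $\mathsf{X}$, $\{(\|\phi\|_\mathsf{X},\|\neg\phi\|_\mathsf{X})\mid\phi\in L\}$ equals the set of pairs in $\mathscr{P}$ over $\mathsf{X}$; it is bicomplete modulo expressive power for $\mathscr{P}$ if it is bicomplete for $\mathscr{P}\cap\{(\|\phi\|,\|\psi\|)\mid\phi,\psi\in L\}$. -}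

module Defs where

open import Level using (Level; 0ℓ) renaming (suc to lsuc)
open import Data.Nat using (ℕ; zero; suc)
open import Data.Fin using (Fin)
open import Data.Bool using (Bool; true; false; T)
open import Data.Product using (Σ; _×_; _,_)
open import Data.Sum using (_⊎_)
open import Data.Empty using (⊥)
open import Relation.Nullary using (¬_)

_⇔_ : {a b : Level} → Set a → Set b → Set (a Level.⊔ b)
A ⇔ B = (A → B) × (B → A)

record Model (n : ℕ) : Set₁ where
  field
    W : Set
    R : W → W → Set
    V : Fin n → W → Set
open Model public

Team : {n : ℕ} → Model n → Set₁
Team M = W M → Set

module _ {n : ℕ} {M : Model n} where
  _⊆_ : Team M → Team M → Set
  s ⊆ t = ∀ w → s w → t w

  _≡_∪_ : Team M → Team M → Team M → Set
  s ≡ t ∪ u = ∀ w → s w ⇔ (t w ⊎ u w)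

  Empty : Team M → Set
  Empty s = ∀ w → ¬ s w

  NonEmpty : Team M → Set
  NonEmpty s = Σ (W M) s

-- Formulas.  Fm n false = BSML over Fin n; Fm n true = BSMLI
-- (global disjunction ⩖ is only available when the flag is true).

data Fm (n : ℕ) (g : Bool) : Set where
  atom : Fin n → Fm n g
  bot  : Fm n g
  neg  : Fm n g → Fm n g
  _∧ᶠ_ : Fm n g → Fm n g → Fm n g
  _∨ᶠ_ : Fm n g → Fm n g → Fm n g
  dia  : Fm n g → Fm n g
  NE   : Fm n g
  gdisj : T g → Fm n g → Fm n g → Fm n g

BSML BSMLI : ℕ → Set
BSML n = Fm n false
BSMLI n = Fm n true

mutual
  _,_⊨_ : {n : ℕ} {g : Bool} (M : Model n) → Team M → Fm n g → Set₁
  M , s ⊨ atom p = Level.Lift (lsuc 0ℓ) (∀ w → s w → V M p w)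
  M , s ⊨ bot = Level.Lift (lsuc 0ℓ) (Empty {M = M} s)
  M , s ⊨ neg φ = M , s ⊨⁻ φ
  M , s ⊨ (φ ∧ᶠ ψ) = (M , s ⊨ φ) × (M , s ⊨ ψ)
  M , s ⊨ (φ ∨ᶠ ψ) =
    Σ (Team M) λ t → Σ (Team M) λ u →
      Level.Lift (lsuc 0ℓ) (_≡_∪_ {M = M} s t u) × (M , t ⊨ φ) × (M , u ⊨ ψ)
  M , s ⊨ dia φ =
    ∀ w → s w → Σ (Team M) λ t →
      Level.Lift (lsuc 0ℓ) (_⊆_ {M = M} t (R M w) × NonEmpty {M = M} t) × (M , t ⊨ φ)
  M , s ⊨ NE = Level.Lift (lsuc 0ℓ) (NonEmpty {M = M} s)
  M , s ⊨ gdisj _ φ ψ = (M , s ⊨ φ) ⊎ (M , s ⊨ ψ)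

  _,_⊨⁻_ : {n : ℕ} {g : Bool} (M : Model n) → Team M → Fm n g → Set₁
  M , s ⊨⁻ atom p = Level.Lift (lsuc 0ℓ) (∀ w → s w → ¬ V M p w)
  M , s ⊨⁻ bot = Level.Lift (lsuc 0ℓ) Data.Unit.⊤
    where import Data.Unit
  M , s ⊨⁻ neg φ = M , s ⊨ φ
  M , s ⊨⁻ (φ ∧ᶠ ψ) =
    Σ (Team M) λ t → Σ (Team M) λ u →
      Level.Lift (lsuc 0ℓ) (_≡_∪_ {M = M} s t u) × (M , t ⊨⁻ φ) × (M , u ⊨⁻ ψ)
  M , s ⊨⁻ (φ ∨ᶠ ψ) = (M , s ⊨⁻ φ) × (M , s ⊨⁻ ψ)
  M , s ⊨⁻ dia φ = ∀ w → s w → M , R M w ⊨⁻ φ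
  M , s ⊨⁻ NE = Level.Lift (lsuc 0ℓ) (Empty {M = M} s)
  M , s ⊨⁻ gdisj _ φ ψ = (M , s ⊨⁻ φ) × (M , s ⊨⁻ ψ)

Property : ℕ → Set₂
Property n = (M : Model n) → Team M → Set₁

_≐_ : {n : ℕ} → Property n → Property n → Set₁
P ≐ Q = ∀ M s → P M s ⇔ Q M s

‖_‖ : {n : ℕ} {g : Bool} → Fm n g → Property n
‖ φ ‖ M s = M , s ⊨ φ

Convex : {n : ℕ} → Property n → Set₁
Convex P = ∀ M (s t u : Team M) → P M s → P M u →
  _⊆_ {M = M} s t → _⊆_ {M = M} t u → P M t

-- closure under unions of arbitrary nonempty collections of teams
UnionClosed : {n : ℕ} → Property n → Set₁
UnionClosed P = ∀ M (I : Set) (i₀ : I) (f : I → Team M) →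
  (∀ i → P M (f i)) → P M (λ w → Σ I λ i → f i w)

SameAtoms : {n : ℕ} (M M' : Model n) → W M → W M' → Set
SameAtoms M M' w w' = ∀ p → V M p w ⇔ V M' p w'

Bisim : {n : ℕ} (k : ℕ) (M M' : Model n) → W M → W M' → Set
Bisim zero M M' w w' = SameAtoms M M' w w'
Bisim (suc k) M M' w w' =
  SameAtoms M M' w w'
  × (∀ v → R M w v → Σ (W M') λ v' → R M' w' v' × Bisim k M M' v v')
  × (∀ v' → R M' w' v' → Σ (W M) λ v → R M w v × Bisim k M M' v v')

TeamBisim : {n : ℕ} (k : ℕ) (M M' : Model n) → Team M → Team M' → Set
TeamBisim k M M' s s' =
  (∀ w → s w → Σ (W M') λ w' → s' w' × Bisim k M M' w w')
  × (∀ w' → s' w' → Σ (W M) λ w → s w × Bisim k M M' w w')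

BBInvariant : {n : ℕ} → Property n → Set₁
BBInvariant {n} P = Σ ℕ λ k → ∀ (M M' : Model n) s s' →
  TeamBisim k M M' s s' → P M s → P M' s'

GroundIncompatible : {n : ℕ} → Property n → Property n → Set₁
GroundIncompatible {n} P Q =
  ¬ (Σ (Model n) λ M → Σ (W M) λ w → Σ (Team M) λ s → Σ (Team M) λ t →
       P M s × s w × Q M t × t w)

PairClass : Set₂
PairClass = (n : ℕ) → Property n → Property n → Set₁

Bicomplete : Bool → PairClass → Set₂
Bicomplete g C = (n : ℕ) →
  ((φ : Fm n g) → C n ‖ φ ‖ ‖ neg φ ‖)
  × ((P Q : Property n) → C n P Q →
       Σ (Fm n g) λ φ → (‖ φ ‖ ≐ P) × (‖ neg φ ‖ ≐ Q))

Expressible : Bool → (n : ℕ) → Property n → Set₁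
Expressible g n P = Σ (Fm n g) λ φ → P ≐ ‖ φ ‖

BicompleteModExpr : Bool → PairClass → Set₂
BicompleteModExpr g C =
  Bicomplete g (λ n P Q → C n P Q × Expressible g n P × Expressible g n Q)

ClassBSML : PairClass
ClassBSML n P Q =
  Convex P × UnionClosed P × BBInvariant P
  × Convex Q × UnionClosed Q × BBInvariant Q
  × GroundIncompatible P Q

ClassBSMLI : PairClass
ClassBSMLI n P Q = BBInvariant P × BBInvariant Q × GroundIncompatible P Q

ClassGI : PairClass
ClassGI n P Q = GroundIncompatible P Q

{-# OPTIONS --safe #-}
-- Soundness is by induction on formulas: support and anti-support are preserved by team bisimulations of
-- the modal depth of the formula, never share a world, and without global disjunction are convex and union
-- closed. For completeness, over finitely many atoms there are finitely many depth-k types, each with a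
-- characteristic formula χ, and worlds of the same depth-k type are k-bisimilar. A k-invariant property P
-- is the global disjunction, over the sets of types realised by P-teams, of the formulas "realises exactly
-- these types". If P is also convex and union closed, a BSML formula suffices: every world has a type
-- occurring in P, and the team escapes every set of types that no P-team fits into; such a team is
-- bisimilar to one squeezed between a P-team and a union of P-teams. Ground incompatibility means that no
-- type occurs in both P and Q, so the disjunction δ of the characteristic formulas of the types occurring
-- in Q is supported by Q-teams and anti-supported by P-teams, and δ glues the defining formulas of P and Q
-- into one formula whose support is P and whose anti-support is Q. Expressible properties have all the
-- closure properties, which gives (iii). Excluded middle computes types and decides which sets of types
-- occur.

module Submission where

open import Defs
open import Level using (0ℓ; Lift; lift; lower) renaming (suc to lsuc)
open import Data.Bool using (Bool; true; false; if_then_else_)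
open import Data.Product using (Σ; _×_; _,_; proj₁; proj₂; map₂; swap)
open import Function using (id; _∘_)
open import Data.Sum as Sum using (_⊎_; inj₁; inj₂; [_,_]′)
open import Data.Empty using (⊥; ⊥-elim)
open import Data.Unit using (⊤; tt)
open import Data.Nat using (ℕ; zero; suc; _≤_; _⊔_; s≤s)
open import Data.Nat.Properties using (m≤m⊔n; m≤n⊔m)
open import Data.Fin using (Fin)
open import Data.List using (List; []; _∷_; map; length; _++_; allFin; cartesianProduct; filter)
open import Data.List.Relation.Unary.All as All using (All; []; _∷_)
open import Data.List.Relation.Unary.All.Properties using (¬All⇒Any¬)
open import Data.List.Relation.Unary.Any using (Any; here; there; toSum)
open import Data.List.Relation.Unary.Any.Properties using (¬Any[])
open import Data.List.Membership.Propositional using (_∈_; find; lose)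
open import Data.List.Membership.Propositional.Properties
  using (∈-map⁺; ∈-++⁺ˡ; ∈-++⁺ʳ; ∈-allFin; ∈-cartesianProduct⁺; ∈-filter⁺; ∈-filter⁻)
open import Data.Vec using (Vec; []; _∷_; lookup; tabulate)
open import Data.Vec.Properties using (lookup∘tabulate)
open import Relation.Binary.PropositionalEquality using (_≡_; refl; sym; subst)
open import Relation.Nullary using (¬_; Dec; yes; no; does)
open import Relation.Nullary.Decidable using (map′; decidable-stable)
open import Axiom.ExcludedMiddle using (ExcludedMiddle)
open import Relation.Unary using (Decidable)

private variable
  n k : ℕ
  g : Bool

⇔-trans : ∀ {a b c} {A : Set a} {B : Set b} {C : Set c} → A ⇔ B → B ⇔ C → A ⇔ C
⇔-trans (f , f⁻¹) (g , g⁻¹) = g ∘ f , f⁻¹ ∘ g⁻¹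

Bisim⇒SameAtoms : ∀ k {M M' : Model n} {w w'} → Bisim k M M' w w' → SameAtoms M M' w w'
Bisim⇒SameAtoms zero b = b
Bisim⇒SameAtoms (suc k) (a , _) = a

Bisim-refl : ∀ k {M : Model n} w → Bisim k M M w w
Bisim-refl zero w p = id , id
Bisim-refl (suc k) w =
  (λ p → id , id) , (λ v r → v , r , Bisim-refl k v) , (λ v r → v , r , Bisim-refl k v)

Bisim-sym : ∀ k {M M' : Model n} {w w'} → Bisim k M M' w w' → Bisim k M' M w' w
Bisim-sym zero a p = swap (a p)
Bisim-sym (suc k) (a , forth , back) =
  (λ p → swap (a p)) ,
  (λ v' r' → map₂ (map₂ (Bisim-sym k)) (back v' r')) ,
  (λ v r → map₂ (map₂ (Bisim-sym k)) (forth v r))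

Bisim-trans : ∀ k {M₁ M₂ M₃ : Model n} {w₁ w₂ w₃} →
  Bisim k M₁ M₂ w₁ w₂ → Bisim k M₂ M₃ w₂ w₃ → Bisim k M₁ M₃ w₁ w₃
Bisim-trans zero a a' p = ⇔-trans (a p) (a' p)
Bisim-trans (suc k) (a , forth , back) (a' , forth' , back') =
  (λ p → ⇔-trans (a p) (a' p)) ,
  (λ v r → let (v₂ , r₂ , b) = forth v r ; (v₃ , r₃ , c) = forth' v₂ r₂ in v₃ , r₃ , Bisim-trans k b c) ,
  (λ v r → let (v₂ , r₂ , c) = back' v r ; (v₁ , r₁ , b) = back v₂ r₂ in v₁ , r₁ , Bisim-trans k b c)

Bisim-≤ : ∀ {k k'} {M M' : Model n} {w w'} → k ≤ k' → Bisim k' M M' w w' → Bisim k M M' w w'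
Bisim-≤ {k = zero} {k'} _ b = Bisim⇒SameAtoms k' b
Bisim-≤ {k = suc k} (s≤s k≤k') (a , forth , back) =
  a , (λ v r → map₂ (map₂ (Bisim-≤ k≤k')) (forth v r)) , (λ v r → map₂ (map₂ (Bisim-≤ k≤k')) (back v r))

TeamBisim-≤ : ∀ {k k'} {M M' : Model n} {s s'} → k ≤ k' → TeamBisim k' M M' s s' → TeamBisim k M M' s s'
TeamBisim-≤ k≤k' (forth , back) =
  (λ w sw → map₂ (map₂ (Bisim-≤ k≤k')) (forth w sw)) , (λ w sw → map₂ (map₂ (Bisim-≤ k≤k')) (back w sw))

TeamBisim-ext : ∀ k {M : Model n} {s t : Team M} → (∀ w → s w ⇔ t w) → TeamBisim k M M s t
TeamBisim-ext k s⇔t =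
  (λ w sw → w , proj₁ (s⇔t w) sw , Bisim-refl k w) , (λ w tw → w , proj₂ (s⇔t w) tw , Bisim-refl k w)

TeamBisim-NonEmpty : ∀ {M M' : Model n} {s s'} → TeamBisim k M M' s s' →
  NonEmpty {M = M} s → NonEmpty {M = M'} s'
TeamBisim-NonEmpty (forth , _) (w , sw) = let (w' , s'w' , _) = forth w sw in w' , s'w'

BisimImage : ∀ k {M M' : Model n} → Team M → Team M' → Team M'
BisimImage k {M} {M'} t s' w' = s' w' × Σ (W M) λ w → t w × Bisim k M M' w w'

TeamBisim-image : ∀ {M M' : Model n} {s t : Team M} {s' : Team M'} →
  TeamBisim k M M' s s' → _⊆_ {M = M} t s → TeamBisim k M M' t (BisimImage k t s')
TeamBisim-image (forth , _) t⊆s =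
  (λ w tw → let (w' , s'w' , b) = forth w (t⊆s w tw) in w' , (s'w' , w , tw , b) , b) ,
  (λ w' (_ , w , tw , b) → w , tw , b)

-- Soundness

Invariant : ℕ → Property n → Set₁
Invariant {n} k P = ∀ (M M' : Model n) s s' → TeamBisim k M M' s s' → P M s → P M' s'

Invariant-≤ : ∀ {k k'} {P : Property n} → k ≤ k' → Invariant k P → Invariant k' P
Invariant-≤ k≤k' inv M M' s s' bis = inv M M' s s' (TeamBisim-≤ k≤k' bis)

_⊗_ : Property n → Property n → Property n
(P ⊗ Q) M s = Σ (Team M) λ t → Σ (Team M) λ u → Lift (lsuc 0ℓ) (_≡_∪_ {M = M} s t u) × P M t × Q M u

◇ᵖ : Property n → Property n
◇ᵖ P M s = ∀ w → s w → Σ (Team M) λ t →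
  Lift (lsuc 0ℓ) (_⊆_ {M = M} t (R M w) × NonEmpty {M = M} t) × P M t

□ᵖ : Property n → Property n
□ᵖ P M s = ∀ w → s w → P M (R M w)

⊗-invariant : {P Q : Property n} → Invariant k P → Invariant k Q → Invariant k (P ⊗ Q)
⊗-invariant {k = k} invP invQ M M' s s' bis@(_ , back) (t , u , lift s≡t∪u , Pt , Qu) =
  BisimImage k t s' , BisimImage k u s' , lift s'≡t'∪u' ,
  invP M M' t _ (TeamBisim-image bis (λ w tw → proj₂ (s≡t∪u w) (inj₁ tw))) Pt ,
  invQ M M' u _ (TeamBisim-image bis (λ w uw → proj₂ (s≡t∪u w) (inj₂ uw))) Qu
  where
  s'≡t'∪u' : _≡_∪_ {M = M'} s' (BisimImage k t s') (BisimImage k u s')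
  s'≡t'∪u' w' = (λ s'w' → let (w , sw , b) = back w' s'w' in
                            [ (λ tw → inj₁ (s'w' , w , tw , b)) , (λ uw → inj₂ (s'w' , w , uw , b)) ]′
                              (proj₁ (s≡t∪u w) sw)) ,
                [ proj₁ , proj₁ ]′

◇ᵖ-invariant : {P : Property n} → Invariant k P → Invariant (suc k) (◇ᵖ P)
◇ᵖ-invariant {k = k} inv M M' s s' (_ , back) ◇P w' s'w' =
  let (w , sw , (_ , forth-R , back-R)) = back w' s'w'
      (t , lift (t⊆Rw , v , tv) , Pt) = ◇P w sw
      t≈t' = TeamBisim-image {k = k} (forth-R , back-R) t⊆Rw
  in BisimImage k t (R M' w') , lift ((λ _ → proj₁) , TeamBisim-NonEmpty t≈t' (v , tv)) , inv M M' t _ t≈t' Pt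

□ᵖ-invariant : {P : Property n} → Invariant k P → Invariant (suc k) (□ᵖ P)
□ᵖ-invariant inv M M' s s' (_ , back) □P w' s'w' =
  let (w , sw , (_ , forth-R , back-R)) = back w' s'w'
  in inv M M' (R M w) (R M' w') (forth-R , back-R) (□P w sw)

depth : Fm n g → ℕ
depth (atom _) = 0
depth bot = 0
depth (neg φ) = depth φ
depth (φ ∧ᶠ ψ) = depth φ ⊔ depth ψ
depth (φ ∨ᶠ ψ) = depth φ ⊔ depth ψ
depth (dia φ) = suc (depth φ)
depth NE = 0
depth (gdisj _ φ ψ) = depth φ ⊔ depth ψ

module _ {P Q : Property n} {k l : ℕ} where
  ×-invariant-⊔ : Invariant k P → Invariant l Q → Invariant (k ⊔ l) (λ M s → P M s × Q M s)
  ×-invariant-⊔ invP invQ M M' s s' bis (Ps , Qs) =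
    Invariant-≤ (m≤m⊔n k l) invP M M' s s' bis Ps , Invariant-≤ (m≤n⊔m k l) invQ M M' s s' bis Qs

  ⊎-invariant-⊔ : Invariant k P → Invariant l Q → Invariant (k ⊔ l) (λ M s → P M s ⊎ Q M s)
  ⊎-invariant-⊔ invP invQ M M' s s' bis =
    [ (λ Ps → inj₁ (Invariant-≤ (m≤m⊔n k l) invP M M' s s' bis Ps)) ,
      (λ Qs → inj₂ (Invariant-≤ (m≤n⊔m k l) invQ M M' s s' bis Qs)) ]′

  ⊗-invariant-⊔ : Invariant k P → Invariant l Q → Invariant (k ⊔ l) (P ⊗ Q)
  ⊗-invariant-⊔ invP invQ = ⊗-invariant (Invariant-≤ (m≤m⊔n k l) invP) (Invariant-≤ (m≤n⊔m k l) invQ)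

mutual
  ⊨-invariant : (φ : Fm n g) → Invariant (depth φ) ‖ φ ‖
  ⊨-invariant (atom p) M M' s s' (_ , back) (lift s⊨p) =
    lift λ w' s'w' → let (w , sw , b) = back w' s'w' in proj₁ (b p) (s⊨p w sw)
  ⊨-invariant bot M M' s s' (_ , back) (lift s≡∅) =
    lift λ w' s'w' → let (w , sw , _) = back w' s'w' in s≡∅ w sw
  ⊨-invariant (neg φ) = ⊨⁻-invariant φ
  ⊨-invariant (φ ∧ᶠ ψ) = ×-invariant-⊔ (⊨-invariant φ) (⊨-invariant ψ)
  ⊨-invariant (φ ∨ᶠ ψ) = ⊗-invariant-⊔ (⊨-invariant φ) (⊨-invariant ψ)
  ⊨-invariant (dia φ) = ◇ᵖ-invariant (⊨-invariant φ)
  ⊨-invariant NE M M' s s' bis (lift ne) = lift (TeamBisim-NonEmpty {k = 0} {M = M} {M'} bis ne)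
  ⊨-invariant (gdisj _ φ ψ) = ⊎-invariant-⊔ (⊨-invariant φ) (⊨-invariant ψ)

  ⊨⁻-invariant : (φ : Fm n g) → Invariant (depth φ) ‖ neg φ ‖
  ⊨⁻-invariant (atom p) M M' s s' (_ , back) (lift s⊨¬p) =
    lift λ w' s'w' → let (w , sw , b) = back w' s'w' in λ pw' → s⊨¬p w sw (proj₂ (b p) pw')
  ⊨⁻-invariant bot M M' s s' _ _ = lift tt
  ⊨⁻-invariant (neg φ) = ⊨-invariant φ
  ⊨⁻-invariant (φ ∧ᶠ ψ) = ⊗-invariant-⊔ (⊨⁻-invariant φ) (⊨⁻-invariant ψ)
  ⊨⁻-invariant (φ ∨ᶠ ψ) = ×-invariant-⊔ (⊨⁻-invariant φ) (⊨⁻-invariant ψ)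
  ⊨⁻-invariant (dia φ) = □ᵖ-invariant (⊨⁻-invariant φ)
  ⊨⁻-invariant NE M M' s s' (_ , back) (lift s≡∅) =
    lift λ w' s'w' → let (w , sw , _) = back w' s'w' in s≡∅ w sw
  ⊨⁻-invariant (gdisj _ φ ψ) = ×-invariant-⊔ (⊨⁻-invariant φ) (⊨⁻-invariant ψ)

‖‖-bbInvariant : (φ : Fm n g) → BBInvariant ‖ φ ‖
‖‖-bbInvariant φ = depth φ , ⊨-invariant φ

⊨-ext : (φ : Fm n g) {M : Model n} {s t : Team M} → (∀ w → s w ⇔ t w) → M , s ⊨ φ → M , t ⊨ φ
⊨-ext φ {M} {s} {t} s⇔t = ⊨-invariant φ M M s t (TeamBisim-ext (depth φ) s⇔t)

mutual
  ⊨-⊨⁻-disjoint : (φ : Fm n g) {M : Model n} {s t : Team M} {w : W M} →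
    M , s ⊨ φ → s w → M , t ⊨⁻ φ → t w → ⊥
  ⊨-⊨⁻-disjoint (atom p) (lift s⊨p) sw (lift t⊨¬p) tw = t⊨¬p _ tw (s⊨p _ sw)
  ⊨-⊨⁻-disjoint bot (lift s≡∅) sw _ _ = s≡∅ _ sw
  ⊨-⊨⁻-disjoint (neg φ) s⊨ sw t⊨⁻ tw = ⊨-⊨⁻-disjoint φ t⊨⁻ tw s⊨ sw
  ⊨-⊨⁻-disjoint (φ ∧ᶠ ψ) {w = w} (s⊨φ , s⊨ψ) sw (t₁ , t₂ , lift t≡t₁∪t₂ , t₁⊨⁻φ , t₂⊨⁻ψ) tw =
    [ ⊨-⊨⁻-disjoint φ s⊨φ sw t₁⊨⁻φ , ⊨-⊨⁻-disjoint ψ s⊨ψ sw t₂⊨⁻ψ ]′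
      (proj₁ (t≡t₁∪t₂ w) tw)
  ⊨-⊨⁻-disjoint (φ ∨ᶠ ψ) {w = w} (s₁ , s₂ , lift s≡s₁∪s₂ , s₁⊨φ , s₂⊨ψ) sw (t⊨⁻φ , t⊨⁻ψ) tw =
    [ (λ s₁w → ⊨-⊨⁻-disjoint φ s₁⊨φ s₁w t⊨⁻φ tw) ,
      (λ s₂w → ⊨-⊨⁻-disjoint ψ s₂⊨ψ s₂w t⊨⁻ψ tw) ]′
      (proj₁ (s≡s₁∪s₂ w) sw)
  ⊨-⊨⁻-disjoint (dia φ) {w = w} s⊨◇φ sw t⊨⁻◇φ tw =
    let (u , lift (u⊆Rw , v , uv) , u⊨φ) = s⊨◇φ w sw in ⊨-⊨⁻-disjoint φ u⊨φ uv (t⊨⁻◇φ w tw) (u⊆Rw v uv)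
  ⊨-⊨⁻-disjoint NE _ _ (lift t≡∅) tw = t≡∅ _ tw
  ⊨-⊨⁻-disjoint (gdisj _ φ ψ) (inj₁ s⊨φ) sw (t⊨⁻φ , _) tw = ⊨-⊨⁻-disjoint φ s⊨φ sw t⊨⁻φ tw
  ⊨-⊨⁻-disjoint (gdisj _ φ ψ) (inj₂ s⊨ψ) sw (_ , t⊨⁻ψ) tw = ⊨-⊨⁻-disjoint ψ s⊨ψ sw t⊨⁻ψ tw

‖‖-groundIncompatible : (φ : Fm n g) → GroundIncompatible ‖ φ ‖ ‖ neg φ ‖
‖‖-groundIncompatible φ (_ , _ , _ , _ , s⊨φ , sw , t⊨⁻φ , tw) = ⊨-⊨⁻-disjoint φ s⊨φ sw t⊨⁻φ tw

-- Binary union, written as the union of a Bool-indexed family so that UnionClosed applies verbatim.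
_∪ᵗ_ : {A : Set} → (A → Set) → (A → Set) → A → Set
(s ∪ᵗ t) w = Σ Bool λ b → (if b then s else t) w

∪ᵗ-closed : {P : Property n} → UnionClosed P → ∀ {M : Model n} {s t : Team M} → P M s → P M t → P M (s ∪ᵗ t)
∪ᵗ-closed uc {M} {s} {t} Ps Pt = uc M Bool true (λ b → if b then s else t) λ { true → Ps ; false → Pt }

module _ {P Q : Property n} where
  ⊗-unionClosed : UnionClosed P → UnionClosed Q → UnionClosed (P ⊗ Q)
  ⊗-unionClosed ucP ucQ M I i₀ f P⊗Qf =
    ⋃ t , ⋃ u , lift ⋃f≡⋃t∪⋃u , ucP M I i₀ t (λ i → proj₁ (proj₂ (proj₂ (proj₂ (P⊗Qf i))))) ,
    ucQ M I i₀ u (λ i → proj₂ (proj₂ (proj₂ (proj₂ (P⊗Qf i)))))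
    where
    t u : I → Team M
    t i = proj₁ (P⊗Qf i)
    u i = proj₁ (proj₂ (P⊗Qf i))
    split : ∀ i w → f i w ⇔ (t i w ⊎ u i w)
    split i = lower (proj₁ (proj₂ (proj₂ (P⊗Qf i))))
    ⋃ : (I → Team M) → Team M
    ⋃ h w = Σ I λ i → h i w
    ⋃f≡⋃t∪⋃u : _≡_∪_ {M = M} (⋃ f) (⋃ t) (⋃ u)
    ⋃f≡⋃t∪⋃u w =
      (λ (i , fiw) → [ (λ tiw → inj₁ (i , tiw)) , (λ uiw → inj₂ (i , uiw)) ]′ (proj₁ (split i w) fiw)) ,
      [ (λ (i , tiw) → i , proj₂ (split i w) (inj₁ tiw)) , (λ (i , uiw) → i , proj₂ (split i w) (inj₂ uiw)) ]′

  -- t splits into tᵢ = sᵢ ∪ (t ∩ uᵢ), and sᵢ ⊆ tᵢ ⊆ sᵢ ∪ uᵢ.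
  ⊗-convex : Convex P → UnionClosed P → Convex Q → UnionClosed Q → Convex (P ⊗ Q)
  ⊗-convex cvP ucP cvQ ucQ M s t u
    (s₁ , s₂ , lift s≡s₁∪s₂ , Ps₁ , Qs₂) (u₁ , u₂ , lift u≡u₁∪u₂ , Pu₁ , Qu₂) s⊆t t⊆u =
    t₁ , t₂ , lift t≡t₁∪t₂ ,
    cvP M s₁ t₁ (s₁ ∪ᵗ u₁) Ps₁ (∪ᵗ-closed {P = P} ucP Ps₁ Pu₁) (λ _ → inj₁) (between s₁ u₁) ,
    cvQ M s₂ t₂ (s₂ ∪ᵗ u₂) Qs₂ (∪ᵗ-closed {P = Q} ucQ Qs₂ Qu₂) (λ _ → inj₁) (between s₂ u₂)
    where
    t₁ t₂ : Team M
    t₁ w = s₁ w ⊎ (t w × u₁ w)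
    t₂ w = s₂ w ⊎ (t w × u₂ w)
    between : (a b : Team M) → _⊆_ {M = M} (λ w → a w ⊎ (t w × b w)) (a ∪ᵗ b)
    between a b w = [ (λ aw → true , aw) , (λ (_ , bw) → false , bw) ]′
    t≡t₁∪t₂ : _≡_∪_ {M = M} t t₁ t₂
    t≡t₁∪t₂ w =
      (λ tw → [ (λ u₁w → inj₁ (inj₂ (tw , u₁w))) , (λ u₂w → inj₂ (inj₂ (tw , u₂w))) ]′
                (proj₁ (u≡u₁∪u₂ w) (t⊆u w tw))) ,
      [ [ (λ s₁w → s⊆t w (proj₂ (s≡s₁∪s₂ w) (inj₁ s₁w))) , proj₁ ]′ ,
        [ (λ s₂w → s⊆t w (proj₂ (s≡s₁∪s₂ w) (inj₂ s₂w))) , proj₁ ]′ ]′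

mutual
  ‖‖-unionClosed : (φ : BSML n) → UnionClosed ‖ φ ‖
  ‖‖-unionClosed (atom p) M I i₀ f Pf = lift λ w (i , fiw) → lower (Pf i) w fiw
  ‖‖-unionClosed bot M I i₀ f Pf = lift λ w (i , fiw) → lower (Pf i) w fiw
  ‖‖-unionClosed (neg φ) = ‖¬‖-unionClosed φ
  ‖‖-unionClosed (φ ∧ᶠ ψ) M I i₀ f Pf =
    ‖‖-unionClosed φ M I i₀ f (proj₁ ∘ Pf) , ‖‖-unionClosed ψ M I i₀ f (proj₂ ∘ Pf)
  ‖‖-unionClosed (φ ∨ᶠ ψ) = ⊗-unionClosed (‖‖-unionClosed φ) (‖‖-unionClosed ψ)
  ‖‖-unionClosed (dia φ) M I i₀ f Pf w (i , fiw) = Pf i w fiw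
  ‖‖-unionClosed NE M I i₀ f Pf = let (w , fi₀w) = lower (Pf i₀) in lift (w , i₀ , fi₀w)

  ‖¬‖-unionClosed : (φ : BSML n) → UnionClosed ‖ neg φ ‖
  ‖¬‖-unionClosed (atom p) M I i₀ f Pf = lift λ w (i , fiw) → lower (Pf i) w fiw
  ‖¬‖-unionClosed bot M I i₀ f Pf = lift tt
  ‖¬‖-unionClosed (neg φ) = ‖‖-unionClosed φ
  ‖¬‖-unionClosed (φ ∧ᶠ ψ) = ⊗-unionClosed (‖¬‖-unionClosed φ) (‖¬‖-unionClosed ψ)
  ‖¬‖-unionClosed (φ ∨ᶠ ψ) M I i₀ f Pf =
    ‖¬‖-unionClosed φ M I i₀ f (proj₁ ∘ Pf) , ‖¬‖-unionClosed ψ M I i₀ f (proj₂ ∘ Pf)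
  ‖¬‖-unionClosed (dia φ) M I i₀ f Pf w (i , fiw) = Pf i w fiw
  ‖¬‖-unionClosed NE M I i₀ f Pf = lift λ w (i , fiw) → lower (Pf i) w fiw

mutual
  ‖‖-convex : (φ : BSML n) → Convex ‖ φ ‖
  ‖‖-convex (atom p) M s t u _ (lift u⊨p) _ t⊆u = lift λ w tw → u⊨p w (t⊆u w tw)
  ‖‖-convex bot M s t u _ (lift u≡∅) _ t⊆u = lift λ w tw → u≡∅ w (t⊆u w tw)
  ‖‖-convex (neg φ) = ‖¬‖-convex φ
  ‖‖-convex (φ ∧ᶠ ψ) M s t u (s⊨φ , s⊨ψ) (u⊨φ , u⊨ψ) s⊆t t⊆u =
    ‖‖-convex φ M s t u s⊨φ u⊨φ s⊆t t⊆u , ‖‖-convex ψ M s t u s⊨ψ u⊨ψ s⊆t t⊆u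
  ‖‖-convex (φ ∨ᶠ ψ) =
    ⊗-convex (‖‖-convex φ) (‖‖-unionClosed φ) (‖‖-convex ψ) (‖‖-unionClosed ψ)
  ‖‖-convex (dia φ) M s t u _ u⊨◇φ _ t⊆u w tw = u⊨◇φ w (t⊆u w tw)
  ‖‖-convex NE M s t u (lift (w , sw)) _ s⊆t _ = lift (w , s⊆t w sw)

  ‖¬‖-convex : (φ : BSML n) → Convex ‖ neg φ ‖
  ‖¬‖-convex (atom p) M s t u _ (lift u⊨¬p) _ t⊆u = lift λ w tw → u⊨¬p w (t⊆u w tw)
  ‖¬‖-convex bot M s t u _ _ _ _ = lift tt
  ‖¬‖-convex (neg φ) = ‖‖-convex φ
  ‖¬‖-convex (φ ∧ᶠ ψ) =
    ⊗-convex (‖¬‖-convex φ) (‖¬‖-unionClosed φ) (‖¬‖-convex ψ) (‖¬‖-unionClosed ψ)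
  ‖¬‖-convex (φ ∨ᶠ ψ) M s t u (s⊨⁻φ , s⊨⁻ψ) (u⊨⁻φ , u⊨⁻ψ) s⊆t t⊆u =
    ‖¬‖-convex φ M s t u s⊨⁻φ u⊨⁻φ s⊆t t⊆u , ‖¬‖-convex ψ M s t u s⊨⁻ψ u⊨⁻ψ s⊆t t⊆u
  ‖¬‖-convex (dia φ) M s t u _ u⊨⁻◇φ _ t⊆u w tw = u⊨⁻◇φ w (t⊆u w tw)
  ‖¬‖-convex NE M s t u _ (lift u≡∅) _ t⊆u = lift λ w tw → u≡∅ w (t⊆u w tw)

∅ᵗ : {A : Set} → A → Set
∅ᵗ _ = ⊥

_∩_ : {A : Set} → (A → Set) → (A → Set) → A → Set
(s ∩ S) w = s w × S w

∪-identityˡ : {A : Set} (s : A → Set) → ∀ w → s w ⇔ (∅ᵗ w ⊎ s w)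
∪-identityˡ s w = inj₂ , [ (λ ()) , id ]′

∪-identityʳ : {A : Set} (s : A → Set) → ∀ w → s w ⇔ (s w ⊎ ∅ᵗ w)
∪-identityʳ s w = inj₁ , [ id , (λ ()) ]′

∪-emptyˡ : {A : Set} {s t u : A → Set} → (∀ w → s w ⇔ (t w ⊎ u w)) → (∀ w → ¬ t w) → ∀ w → u w ⇔ s w
∪-emptyˡ s≡t∪u t≡∅ w = (λ uw → proj₂ (s≡t∪u w) (inj₂ uw)) , λ sw → [ ⊥-elim ∘ t≡∅ w , id ]′ (proj₁ (s≡t∪u w) sw)

∪-emptyʳ : {A : Set} {s t u : A → Set} → (∀ w → s w ⇔ (t w ⊎ u w)) → (∀ w → ¬ u w) → ∀ w → t w ⇔ s w
∪-emptyʳ s≡t∪u u≡∅ w = (λ tw → proj₂ (s≡t∪u w) (inj₁ tw)) , λ sw → [ id , ⊥-elim ∘ u≡∅ w ]′ (proj₁ (s≡t∪u w) sw)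

⊗-cover : {P Q : Property n} {M : Model n} {s : Team M} (A B : W M → Set) →
  (∀ w → s w → A w ⊎ B w) → P M (s ∩ A) → Q M (s ∩ B) → (P ⊗ Q) M s
⊗-cover A B cover Pa Qb =
  _ , _ , lift (λ w → (λ sw → Sum.map (sw ,_) (sw ,_) (cover w sw)) , [ proj₁ , proj₁ ]′) , Pa , Qb

⋀ ⋁ : List (Fm n g) → Fm n g
⋀ [] = neg bot
⋀ (φ ∷ φs) = φ ∧ᶠ ⋀ φs
⋁ [] = bot
⋁ (φ ∷ φs) = φ ∨ᶠ ⋁ φs

□ : Fm n g → Fm n g
□ φ = neg (dia (neg φ))

contains : Fm n g → Fm n g
contains φ = (φ ∧ᶠ NE) ∨ᶠ neg bot

-- Supported, and anti-supported, exactly by the empty team.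
ζ : Fm n g
ζ = dia (neg (NE ∨ᶠ (bot ∧ᶠ NE)))

module _ {M : Model n} {A : Set} (f : A → Fm n g) where
  ⊨-⋀⁺ : {s : Team M} (xs : List A) → All (λ x → M , s ⊨ f x) xs → M , s ⊨ ⋀ (map f xs)
  ⊨-⋀⁺ [] [] = lift tt
  ⊨-⋀⁺ (x ∷ xs) (h ∷ hs) = h , ⊨-⋀⁺ xs hs

  ⊨-⋀⁻ : {s : Team M} (xs : List A) → M , s ⊨ ⋀ (map f xs) → All (λ x → M , s ⊨ f x) xs
  ⊨-⋀⁻ [] _ = []
  ⊨-⋀⁻ (x ∷ xs) (h , hs) = h ∷ ⊨-⋀⁻ xs hs

  ⊨⁻-⋀ : {s : Team M} (xs : List A) → M , s ⊨ ⋁ (map (neg ∘ f) xs) → M , s ⊨⁻ ⋀ (map f xs)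
  ⊨⁻-⋀ [] s≡∅ = s≡∅
  ⊨⁻-⋀ (x ∷ xs) (t , u , s≡t∪u , t⊨⁻fx , u⊨) = t , u , s≡t∪u , t⊨⁻fx , ⊨⁻-⋀ xs u⊨

  ∅⊨⁻-⋀ : (xs : List A) → All (λ x → M , ∅ᵗ ⊨⁻ f x) xs → M , ∅ᵗ ⊨⁻ ⋀ (map f xs)
  ∅⊨⁻-⋀ [] [] = lift λ _ ()
  ∅⊨⁻-⋀ (x ∷ xs) (h ∷ hs) = ∅ᵗ , ∅ᵗ , lift (∪-identityˡ ∅ᵗ) , h , ∅⊨⁻-⋀ xs hs

  ⊨⁻-⋁⁺ : {s : Team M} (xs : List A) → All (λ x → M , s ⊨⁻ f x) xs → M , s ⊨⁻ ⋁ (map f xs)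
  ⊨⁻-⋁⁺ [] [] = lift tt
  ⊨⁻-⋁⁺ (x ∷ xs) (h ∷ hs) = h , ⊨⁻-⋁⁺ xs hs

  module _ (S : A → W M → Set) where
    ⊨-⋁⁺ : (∀ x t → (∀ w → t w → S x w) → M , t ⊨ f x) →
      ∀ xs s → (∀ w → s w → Any (λ x → S x w) xs) → M , s ⊨ ⋁ (map f xs)
    ⊨-⋁⁺ _ [] s cover = lift λ w sw → ¬Any[] (cover w sw)
    ⊨-⋁⁺ H (x ∷ xs) s cover =
      ⊗-cover {P = ‖ f x ‖} {Q = ‖ ⋁ (map f xs) ‖} (S x) (λ w → Any (λ y → S y w) xs)
        (λ w sw → toSum (cover w sw)) (H x _ (λ _ → proj₂)) (⊨-⋁⁺ H xs _ (λ _ → proj₂))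

    ⊨-⋁⁻ : (∀ x t → M , t ⊨ f x → ∀ w → t w → S x w) →
      ∀ xs s → M , s ⊨ ⋁ (map f xs) → ∀ w → s w → Any (λ x → S x w) xs
    ⊨-⋁⁻ _ [] s (lift s≡∅) w sw = ⊥-elim (s≡∅ w sw)
    ⊨-⋁⁻ H (x ∷ xs) s (t , u , lift s≡t∪u , t⊨fx , u⊨) w sw =
      [ (λ tw → here (H x t t⊨fx w tw)) , (λ uw → there (⊨-⋁⁻ H xs u u⊨ w uw)) ]′ (proj₁ (s≡t∪u w) sw)

module _ {M : Model n} where
  ⊨⁻-∧-emptyˡ : {s : Team M} {φ ψ : Fm n g} → M , ∅ᵗ ⊨⁻ φ → M , s ⊨⁻ ψ → M , s ⊨⁻ (φ ∧ᶠ ψ)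
  ⊨⁻-∧-emptyˡ {s = s} ∅⊨⁻φ s⊨⁻ψ = ∅ᵗ , s , lift (∪-identityˡ s) , ∅⊨⁻φ , s⊨⁻ψ

  ⊨-∨-emptyʳ : {s : Team M} {φ ψ : Fm n g} → M , s ⊨ φ → M , ∅ᵗ ⊨ ψ → M , s ⊨ (φ ∨ᶠ ψ)
  ⊨-∨-emptyʳ {s = s} s⊨φ ∅⊨ψ = s , ∅ᵗ , lift (∪-identityʳ s) , s⊨φ , ∅⊨ψ

  ⊨-singleton-◇ : {φ : Fm n g} {w u : W M} → R M w u → M , (_≡ u) ⊨ φ →
    Σ (Team M) λ t → Lift (lsuc 0ℓ) (_⊆_ {M = M} t (R M w) × NonEmpty {M = M} t) × M , t ⊨ φ
  ⊨-singleton-◇ Rwu h = _ , lift ((λ { _ refl → Rwu }) , _ , refl) , h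

  contains⁺ : {s t : Team M} {φ : Fm n g} → _⊆_ {M = M} t s → NonEmpty {M = M} t → M , t ⊨ φ → M , s ⊨ contains φ
  contains⁺ {s = s} {t} t⊆s ne t⊨φ = t , s , lift (λ w → inj₂ , [ t⊆s w , id ]′) , (t⊨φ , lift ne) , lift tt

  contains⁻ : {s : Team M} {φ : Fm n g} → M , s ⊨ contains φ →
    Σ (Team M) λ t → _⊆_ {M = M} t s × NonEmpty {M = M} t × M , t ⊨ φ
  contains⁻ (t , u , lift s≡t∪u , (t⊨φ , lift ne) , _) = t , (λ w tw → proj₂ (s≡t∪u w) (inj₁ tw)) , ne , t⊨φ

  ∅⊨⁻-contains : {φ : Fm n g} → M , ∅ᵗ ⊨⁻ φ → M , ∅ᵗ ⊨⁻ contains φ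
  ∅⊨⁻-contains ∅⊨⁻φ = (∅ᵗ , ∅ᵗ , lift (∪-identityˡ ∅ᵗ) , ∅⊨⁻φ , lift λ _ ()) , lift λ _ ()

  ζ-support : {s : Team M} → M , s ⊨ ζ {g = g} → Empty {M = M} s
  ζ-support s⊨ζ w sw = let (_ , lift (_ , v , tv) , lift t≡∅ , _) = s⊨ζ w sw in t≡∅ v tv

  ζ-antiSupport : {s : Team M} → M , s ⊨⁻ ζ {g = g} → Empty {M = M} s
  ζ-antiSupport s⊨⁻ζ w sw = let (_ , _ , _ , _ , lift u≡∅ , lift (v , uv)) = s⊨⁻ζ w sw in u≡∅ v uv

  ⊨-∨ζ : (φ : Fm n g) {s : Team M} → M , s ⊨ (φ ∨ᶠ ζ) → M , s ⊨ φ
  ⊨-∨ζ {g = g} φ (t , u , lift s≡t∪u , t⊨φ , u⊨ζ) = ⊨-ext φ (∪-emptyʳ s≡t∪u (ζ-support {g = g} u⊨ζ)) t⊨φ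

⩖ : {A : Set} → (A → BSMLI n) → List A → BSMLI n
⩖ f [] = bot ∧ᶠ NE
⩖ f (x ∷ xs) = gdisj tt (f x) (⩖ f xs)

module _ {M : Model n} {A : Set} (f : A → BSMLI n) where
  ⊨-⩖⁺ : {s : Team M} {xs : List A} → Any (λ x → M , s ⊨ f x) xs → M , s ⊨ ⩖ f xs
  ⊨-⩖⁺ (here h) = inj₁ h
  ⊨-⩖⁺ (there h) = inj₂ (⊨-⩖⁺ h)

  ⊨-⩖⁻ : {s : Team M} (xs : List A) → M , s ⊨ ⩖ f xs → Any (λ x → M , s ⊨ f x) xs
  ⊨-⩖⁻ [] (lift s≡∅ , lift (w , sw)) = ⊥-elim (s≡∅ w sw)
  ⊨-⩖⁻ (x ∷ xs) (inj₁ h) = here h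
  ⊨-⩖⁻ (x ∷ xs) (inj₂ h) = there (⊨-⩖⁻ xs h)

  ⊨⁻-⩖ : {s : Team M} (xs : List A) → All (λ x → M , s ⊨⁻ f x) xs → M , s ⊨⁻ ⩖ f xs
  ⊨⁻-⩖ {s} [] [] = s , ∅ᵗ , lift (∪-identityʳ s) , lift tt , lift λ _ ()
  ⊨⁻-⩖ (x ∷ xs) (h ∷ hs) = h , ⊨⁻-⩖ xs hs

-- Types and characteristic formulas

allVecs : (m : ℕ) → List (Vec Bool m)
allVecs zero = [] ∷ []
allVecs (suc m) = map (true ∷_) (allVecs m) ++ map (false ∷_) (allVecs m)

∈-allVecs : ∀ {m} (v : Vec Bool m) → v ∈ allVecs m
∈-allVecs [] = here refl
∈-allVecs (true ∷ v) = ∈-++⁺ˡ (∈-map⁺ (true ∷_) (∈-allVecs v))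
∈-allVecs {suc m} (false ∷ v) = ∈-++⁺ʳ (map (true ∷_) (allVecs m)) (∈-map⁺ (false ∷_) (∈-allVecs v))

module _ {A : Set} where
  select reject : (xs : List A) → Vec Bool (length xs) → List A
  select [] [] = []
  select (x ∷ xs) (true ∷ m) = x ∷ select xs m
  select (x ∷ xs) (false ∷ m) = select xs m
  reject [] [] = []
  reject (x ∷ xs) (true ∷ m) = reject xs m
  reject (x ∷ xs) (false ∷ m) = x ∷ reject xs m

  ∈-select⊎reject : ∀ {x} {xs} (m : Vec Bool (length xs)) → x ∈ xs → x ∈ select xs m ⊎ x ∈ reject xs m
  ∈-select⊎reject (true ∷ m) (here refl) = inj₁ (here refl)
  ∈-select⊎reject (false ∷ m) (here refl) = inj₂ (here refl)
  ∈-select⊎reject (true ∷ m) (there x∈xs) = Sum.map₁ there (∈-select⊎reject m x∈xs)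
  ∈-select⊎reject (false ∷ m) (there x∈xs) = Sum.map₂ there (∈-select⊎reject m x∈xs)

  module _ {p} {P : A → Set p} (P? : Decidable P) where
    mask : (xs : List A) → Vec Bool (length xs)
    mask [] = []
    mask (x ∷ xs) = does (P? x) ∷ mask xs

    ∈-select-mask⁺ : ∀ {x xs} → x ∈ xs → P x → x ∈ select xs (mask xs)
    ∈-select-mask⁺ {xs = y ∷ xs} x∈xs Px with P? y | x∈xs
    ... | yes _ | here refl = here refl
    ... | yes _ | there x∈xs′ = there (∈-select-mask⁺ x∈xs′ Px)
    ... | no ¬Py | here refl = ⊥-elim (¬Py Px)
    ... | no _ | there x∈xs′ = ∈-select-mask⁺ x∈xs′ Px

    ∈-select-mask⁻ : ∀ {x} xs → x ∈ select xs (mask xs) → P x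
    ∈-select-mask⁻ (y ∷ xs) x∈sel with P? y | x∈sel
    ... | yes Py | here refl = Py
    ... | yes _ | there x∈sel′ = ∈-select-mask⁻ xs x∈sel′
    ... | no _ | x∈sel′ = ∈-select-mask⁻ xs x∈sel′

    ∈-reject-mask⁻ : ∀ {x} xs → x ∈ reject xs (mask xs) → ¬ P x
    ∈-reject-mask⁻ (y ∷ xs) x∈rej with P? y | x∈rej
    ... | yes _ | x∈rej′ = ∈-reject-mask⁻ xs x∈rej′
    ... | no ¬Py | here refl = ¬Py
    ... | no _ | there x∈rej′ = ∈-reject-mask⁻ xs x∈rej′

Lit : Bool → Set → Set
Lit true A = A
Lit false A = ¬ A

Lit-⇔ : ∀ b {A B : Set} → Lit b A → Lit b B → A ⇔ B
Lit-⇔ true a b = (λ _ → b) , (λ _ → a)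
Lit-⇔ false ¬a ¬b = (λ a → ⊥-elim (¬a a)) , (λ b → ⊥-elim (¬b b))

Lit-does : {A : Set} (a? : Dec A) → Lit (does a?) A
Lit-does (yes a) = a
Lit-does (no ¬a) = ¬a

lit : Bool → Fin n → Fm n g
lit true p = atom p
lit false p = neg (atom p)

module _ {M : Model n} where
  ⊨-lit⁺ : ∀ b p {s : Team M} → (∀ w → s w → Lit b (V M p w)) → M , s ⊨ lit {g = g} b p
  ⊨-lit⁺ true p h = lift h
  ⊨-lit⁺ false p h = lift h

  ⊨-lit⁻ : ∀ b p {s : Team M} → M , s ⊨ lit {g = g} b p → ∀ w → s w → Lit b (V M p w)
  ⊨-lit⁻ true p (lift h) = h
  ⊨-lit⁻ false p (lift h) = h

module Characteristic (n : ℕ) where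
  Realises : Vec Bool n → (M : Model n) → W M → Set
  Realises v M w = ∀ p → Lit (lookup v p) (V M p w)

  Realises⇒SameAtoms : ∀ v {M M' : Model n} {w w'} → Realises v M w → Realises v M' w' → SameAtoms M M' w w'
  Realises⇒SameAtoms v a a' p = Lit-⇔ (lookup v p) (a p) (a' p)

  lits : Vec Bool n → Fm n g
  lits v = ⋀ (map (λ p → lit (lookup v p) p) (allFin n))

  module _ {M : Model n} where
    ⊨-lits⁺ : ∀ v {s : Team M} → (∀ w → s w → Realises v M w) → M , s ⊨ lits {g = g} v
    ⊨-lits⁺ v h =
      ⊨-⋀⁺ (λ p → lit (lookup v p) p) (allFin n) (All.tabulate λ {p} _ → ⊨-lit⁺ {M = M} (lookup v p) p λ w sw → h w sw p)

    ⊨-lits⁻ : ∀ v {s : Team M} → M , s ⊨ lits {g = g} v → ∀ w → s w → Realises v M w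
    ⊨-lits⁻ v h w sw p =
      ⊨-lit⁻ (lookup v p) p (All.lookup (⊨-⋀⁻ (λ p → lit (lookup v p) p) (allFin n) h) (∈-allFin p)) w sw

  -- A type of depth k + 1 is a valuation together with a mask selecting the depth-k types of the successors.
  mutual
    Type : ℕ → Set
    Type zero = Vec Bool n
    Type (suc k) = Vec Bool n × Vec Bool (length (types k))

    types : (k : ℕ) → List (Type k)
    types zero = allVecs n
    types (suc k) = cartesianProduct (allVecs n) (allVecs (length (types k)))

  Mask : ℕ → Set
  Mask k = Vec Bool (length (types k))

  mutual
    HasType : ∀ k → Type k → (M : Model n) → W M → Set
    HasType zero v M w = Realises v M w
    HasType (suc k) (v , m) M w = Realises v M w × HasTeamType k (select (types k) m) M (R M w)

    HasTeamType : ∀ k → List (Type k) → (M : Model n) → Team M → Set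
    HasTeamType k τs M s =
      (∀ w → s w → Any (λ τ → HasType k τ M w) τs) × All (λ τ → Σ (W M) λ w → s w × HasType k τ M w) τs

  mutual
    HasType⇒Bisim : ∀ k τ {M M' : Model n} {w w'} → HasType k τ M w → HasType k τ M' w' → Bisim k M M' w w'
    HasType⇒Bisim zero v {M} {M'} a a' = Realises⇒SameAtoms v {M} {M'} a a'
    HasType⇒Bisim (suc k) (v , m) {M} {M'} (a , T) (a' , T') =
      Realises⇒SameAtoms v {M} {M'} a a' , HasTeamType⇒TeamBisim k (select (types k) m) T T'

    HasTeamType⇒TeamBisim : ∀ k τs {M M' : Model n} {s s'} →
      HasTeamType k τs M s → HasTeamType k τs M' s' → TeamBisim k M M' s s'
    HasTeamType⇒TeamBisim k τs (cover , realised) (cover' , realised') =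
      (λ w sw → let (τ , τ∈ , wτ) = find (cover w sw) ; (w' , s'w' , w'τ) = All.lookup realised' τ∈
                in w' , s'w' , HasType⇒Bisim k τ wτ w'τ) ,
      (λ w' s'w' → let (τ , τ∈ , w'τ) = find (cover' w' s'w') ; (w , sw , wτ) = All.lookup realised τ∈
                   in w , sw , HasType⇒Bisim k τ wτ w'τ)

  χ : ∀ k → Type k → Fm n g
  χ zero v = lits v
  χ (suc k) (v , m) = lits v ∧ᶠ (⋀ (map (dia ∘ χ k) τs) ∧ᶠ □ (⋁ (map (χ k) τs)))
    where τs = select (types k) m

  θ : ∀ k → List (Type k) → Fm n g
  θ k τs = ⋁ (map (χ k) τs) ∧ᶠ ⋀ (map (contains ∘ χ k) τs)

  module _ {M : Model n} where
    χ⁺ : ∀ k τ {s : Team M} → (∀ w → s w → HasType k τ M w) → M , s ⊨ χ {g = g} k τ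
    χ⁺ zero v h = ⊨-lits⁺ v h
    χ⁺ (suc k) (v , m) {s} h =
      ⊨-lits⁺ v (λ w sw → proj₁ (h w sw)) ,
      ⊨-⋀⁺ (dia ∘ χ k) _ (All.tabulate ◇successor) ,
      λ w sw → ⊨-⋁⁺ (χ k) (λ τ → HasType k τ M) (λ τ t → χ⁺ k τ) _ (R M w) (proj₁ (proj₂ (h w sw)))
      where
      ◇successor : ∀ {τ} → τ ∈ select (types k) m → M , s ⊨ dia (χ {g = g} k τ)
      ◇successor {τ = τ} τ∈ w sw =
        let (u , Rwu , uτ) = All.lookup (proj₂ (proj₂ (h w sw))) τ∈
        in ⊨-singleton-◇ {M = M} {φ = χ k τ} Rwu (χ⁺ k τ λ { _ refl → uτ })

    χ⁻ : ∀ k τ {s : Team M} → M , s ⊨ χ {g = g} k τ → ∀ w → s w → HasType k τ M w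
    χ⁻ zero v h = ⊨-lits⁻ v h
    χ⁻ (suc k) (v , m) {s} (h-lits , h-◇ , h-□) w sw =
      ⊨-lits⁻ v h-lits w sw ,
      ⊨-⋁⁻ (χ k) (λ τ → HasType k τ M) (λ τ t → χ⁻ k τ) _ (R M w) (h-□ w sw) ,
      All.map successor (⊨-⋀⁻ (dia ∘ χ k) _ h-◇)
      where
      successor : ∀ {τ} → M , s ⊨ dia (χ {g = g} k τ) → Σ (W M) λ u → R M w u × HasType k τ M u
      successor {τ = τ} h◇τ =
        let (t , lift (t⊆Rw , u , tu) , t⊨χ) = h◇τ w sw in u , t⊆Rw u tu , χ⁻ k τ t⊨χ u tu

    θ⁺ : ∀ k τs {s : Team M} → HasTeamType k τs M s → M , s ⊨ θ {g = g} k τs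
    θ⁺ k τs {s} (cover , realised) =
      ⊨-⋁⁺ (χ k) (λ τ → HasType k τ M) (λ τ t → χ⁺ k τ) τs _ cover ,
      ⊨-⋀⁺ (contains ∘ χ k) τs (All.map containsWitness realised)
      where
      containsWitness : ∀ {τ} → Σ (W M) (λ w → s w × HasType k τ M w) → M , s ⊨ contains (χ {g = g} k τ)
      containsWitness {τ = τ} (w , sw , wτ) =
        contains⁺ {M = M} {t = _≡ w} {φ = χ k τ} (λ { _ refl → sw }) (w , refl) (χ⁺ k τ λ { _ refl → wτ })

    θ⁻ : ∀ k τs {s : Team M} → M , s ⊨ θ {g = g} k τs → HasTeamType k τs M s
    θ⁻ k τs {s} (h-⋁ , h-⋀) =
      ⊨-⋁⁻ (χ k) (λ τ → HasType k τ M) (λ τ t → χ⁻ k τ) τs _ h-⋁ ,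
      All.map witness (⊨-⋀⁻ (contains ∘ χ k) τs h-⋀)
      where
      witness : ∀ {τ} → M , s ⊨ contains (χ {g = g} k τ) → Σ (W M) λ w → s w × HasType k τ M w
      witness {τ = τ} h =
        let (t , t⊆s , (w , tw) , t⊨χ) = contains⁻ {M = M} {φ = χ k τ} h in w , t⊆s w tw , χ⁻ k τ t⊨χ w tw

record NearGround (k : ℕ) (P : Property n) (M : Model n) (w : W M) : Set₁ where
  field
    model : Model n
    team : Team model
    point : W model
    P-team : P model team
    point∈team : team point
    point≈w : Bisim k model M point w

module DisjointUnion {J : Set} (Mf : J → Model n) where
  data Edge : Σ J (W ∘ Mf) → Σ J (W ∘ Mf) → Set where
    edge : ∀ {j x y} → R (Mf j) x y → Edge (j , x) (j , y)

  ⨆ : Model n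
  ⨆ = record { W = Σ J (W ∘ Mf) ; R = Edge ; V = λ p (j , x) → V (Mf j) p x }

  data _↑_ (j : J) (t : Team (Mf j)) : Σ J (W ∘ Mf) → Set where
    ι : ∀ {x} → t x → (j ↑ t) (j , x)

  ι-Bisim : ∀ k j x → Bisim k (Mf j) ⨆ x (j , x)
  ι-Bisim zero j x p = id , id
  ι-Bisim (suc k) j x =
    (λ p → id , id) , (λ y Rxy → (j , y) , edge Rxy , ι-Bisim k j y) , λ { (_ , y) (edge Rxy) → y , Rxy , ι-Bisim k j y }

  ↑-TeamBisim : ∀ k j (t : Team (Mf j)) → TeamBisim k (Mf j) ⨆ t (j ↑ t)
  ↑-TeamBisim k j t = (λ x tx → (j , x) , ι tx , ι-Bisim k j x) , λ { (_ , x) (ι tx) → x , tx , ι-Bisim k j x }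

-- The union of the P-teams witnessing NearGround and of (a copy of) s' is in P by union closure, so
-- convexity puts into P the team made of s' and the witnessing points, which is k-bisimilar to s.
sandwiched : {P : Property n} → Convex P → UnionClosed P → Invariant k P →
  ∀ {M M' : Model n} {s : Team M} {s' : Team M'} → P M' s' →
  (∀ y → s' y → Σ (W M) λ w → s w × Bisim k M' M y w) → (∀ w → s w → NearGround k P M w) → P M s
sandwiched {n = n} {k = k} {P = P} cvP ucP invP {M} {M'} {s} {s'} Ps' s'≈s near =
  invP ⨆ M t s t≈s (cvP ⨆ (base ↑ s') t U P↑s' PU (λ _ → inj₁) t⊆U)
  where
  J : Set
  J = ⊤ ⊎ Σ (W M) s
  base : J
  base = inj₁ tt
  Mf : J → Model n
  Mf (inj₁ _) = M'
  Mf (inj₂ (w , sw)) = NearGround.model (near w sw)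
  team : (j : J) → Team (Mf j)
  team (inj₁ _) = s'
  team (inj₂ (w , sw)) = NearGround.team (near w sw)
  P-team : ∀ j → P (Mf j) (team j)
  P-team (inj₁ _) = Ps'
  P-team (inj₂ (w , sw)) = NearGround.P-team (near w sw)
  point : (ws : Σ (W M) s) → W (Mf (inj₂ ws))
  point (w , sw) = NearGround.point (near w sw)
  open DisjointUnion Mf
  U t : Team ⨆
  U y = Σ J λ j → (j ↑ team j) y
  t y = (base ↑ s') y ⊎ Σ (Σ (W M) s) λ ws → (inj₂ ws ↑ (_≡ point ws)) y
  P↑s' : P ⨆ (base ↑ s')
  P↑s' = invP M' ⨆ s' _ (↑-TeamBisim k base s') Ps'
  PU : P ⨆ U
  PU = ucP ⨆ J base (λ j → j ↑ team j) λ j → invP (Mf j) ⨆ (team j) _ (↑-TeamBisim k j (team j)) (P-team j)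
  t⊆U : _⊆_ {M = ⨆} t U
  t⊆U _ (inj₁ s'y) = base , s'y
  t⊆U _ (inj₂ ((w , sw) , ι refl)) = inj₂ (w , sw) , ι (NearGround.point∈team (near w sw))
  point≈w : ∀ w sw → Bisim k ⨆ M (inj₂ (w , sw) , point (w , sw)) w
  point≈w w sw = Bisim-trans k (Bisim-sym k (ι-Bisim k _ _)) (NearGround.point≈w (near w sw))
  t≈s : TeamBisim k ⨆ M t s
  t≈s =
    (λ { _ (inj₁ (ι {y} s'y)) →
           let (w , sw , y≈w) = s'≈s y s'y in w , sw , Bisim-trans k (Bisim-sym k (ι-Bisim k base y)) y≈w
       ; _ (inj₂ ((w , sw) , ι refl)) → w , sw , point≈w w sw }) ,
    λ w sw → _ , inj₂ ((w , sw) , ι refl) , point≈w w sw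

-- In the disjoint union, p plus the Q-point x is still a P-team, and it shares x with the copy of the Q-team.
GroundIncompatible⇒¬NearGround : ∀ {k l} {P Q : Property n} → GroundIncompatible P Q → Invariant k P → Invariant l Q →
  ∀ {M} {p : Team M} {w} → P M p → p w → ¬ NearGround k Q M w
GroundIncompatible⇒¬NearGround {k = k} {l} {P} gi invP invQ {M} {p} {w} Pp pw near =
  gi (⨆ , (false , x) , p̂ , (false ↑ q) , Pp̂ , inj₂ refl , invQ N ⨆ q _ (↑-TeamBisim l false q) Qq , ι qx)
  where
  open NearGround near renaming (model to N; team to q; point to x; P-team to Qq; point∈team to qx; point≈w to x≈w)
  open DisjointUnion (λ b → if b then M else N)
  p̂ : Team ⨆
  p̂ y = (true ↑ p) y ⊎ y ≡ (false , x)
  Pp̂ : P ⨆ p̂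
  Pp̂ = invP M ⨆ p p̂
    ((λ y py → (true , y) , inj₁ (ι py) , ι-Bisim k true y) ,
     λ { _ (inj₁ (ι {y} py)) → y , py , ι-Bisim k true y
       ; _ (inj₂ refl) → w , pw , Bisim-trans k (Bisim-sym k x≈w) (ι-Bisim k false x) })
    Pp

-- Completeness

_⊆ᵖ_ : Property n → Property n → Set₁
P ⊆ᵖ Q = ∀ M s → P M s → Q M s

NormalForm : Bool → Property n → Set₁
NormalForm {n} g P = Σ (Fm n g) λ α → (‖ α ‖ ≐ P) × (∀ M → M , ∅ᵗ ⊨⁻ α)

Separator : Bool → Property n → Property n → Set₁
Separator {n} g P Q = Σ (Fm n g) λ δ → (Q ⊆ᵖ ‖ δ ‖) × (P ⊆ᵖ ‖ neg δ ‖)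

-- Adding the disjunct ζ leaves support unchanged but lets only the empty team anti-support α ∨ ζ, so the
-- anti-support of φ reduces to the support of (β ∨ ζ) ∧ δ; δ is what makes P-teams anti-support that conjunct.
bicompletion : {P Q : Property n} → NormalForm g P → NormalForm g Q → Separator g P Q →
  Σ (Fm n g) λ φ → (‖ φ ‖ ≐ P) × (‖ neg φ ‖ ≐ Q)
bicompletion {n = n} {g = g} {P = P} {Q} (α , α≐P , ∅⊨⁻α) (β , β≐Q , ∅⊨⁻β) (δ , Q⊆δ , P⊆¬δ) =
  (α ∨ᶠ ζ) ∧ᶠ neg ((β ∨ᶠ ζ) ∧ᶠ δ) ,
  (λ M s → support M s , λ Ps →
     ⊨-∨-emptyʳ {M = M} {φ = α} {ψ = ζ} (proj₂ (α≐P M s) Ps) (λ _ ()) ,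
     ⊨⁻-∧-emptyˡ {M = M} {φ = β ∨ᶠ ζ} {ψ = δ} (∅⊨⁻β M , λ _ ()) (P⊆¬δ M s Ps)) ,
  (λ M s → antiSupport M s , λ Qs →
     ⊨⁻-∧-emptyˡ {M = M} {φ = α ∨ᶠ ζ} {ψ = neg ((β ∨ᶠ ζ) ∧ᶠ δ)} (∅⊨⁻α M , λ _ ())
       (⊨-∨-emptyʳ {M = M} {φ = β} {ψ = ζ} (proj₂ (β≐Q M s) Qs) (λ _ ()) , Q⊆δ M s Qs))
  where
  support : ∀ M s → M , s ⊨ ((α ∨ᶠ ζ) ∧ᶠ neg ((β ∨ᶠ ζ) ∧ᶠ δ)) → P M s
  support M s (s⊨α∨ζ , _) = proj₁ (α≐P M s) (⊨-∨ζ α s⊨α∨ζ)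
  antiSupport : ∀ M s → M , s ⊨⁻ ((α ∨ᶠ ζ) ∧ᶠ neg ((β ∨ᶠ ζ) ∧ᶠ δ)) → Q M s
  antiSupport M s (t , u , lift s≡t∪u , (_ , t⊨⁻ζ) , (u⊨β∨ζ , _)) =
    proj₁ (β≐Q M s) (⊨-ext β (∪-emptyˡ s≡t∪u (ζ-antiSupport {M = M} {g = g} t⊨⁻ζ)) (⊨-∨ζ β u⊨β∨ζ))

module Classical (em : ExcludedMiddle (lsuc 0ℓ)) (n : ℕ) where
  open Characteristic n

  dec : (A : Set) → Dec A
  dec A = map′ lower lift em

  dne : {A : Set} → ¬ ¬ A → A
  dne = decidable-stable (dec _)

  dne₁ : {A : Set₁} → ¬ ¬ A → A
  dne₁ = decidable-stable em

  ¬×⇒¬⊎¬ : {A B : Set} → ¬ (A × B) → ¬ A ⊎ ¬ B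
  ¬×⇒¬⊎¬ {A} ¬ab with dec A
  ... | yes a = inj₂ λ b → ¬ab (a , b)
  ... | no ¬a = inj₁ ¬a

  ¬∀⇒∃¬ : {A : Set} {B : A → Set} → ¬ (∀ x → B x) → Σ A λ x → ¬ B x
  ¬∀⇒∃¬ ¬∀ = dne λ ¬∃ → ¬∀ λ x → dne λ ¬Bx → ¬∃ (x , ¬Bx)

  ¬∀→⇒∃×¬ : {A : Set} {B C : A → Set} → ¬ (∀ x → B x → C x) → Σ A λ x → B x × ¬ C x
  ¬∀→⇒∃×¬ ¬∀ =
    let (x , ¬B→C) = ¬∀⇒∃¬ ¬∀ in x , dne (λ ¬Bx → ¬B→C λ Bx → ⊥-elim (¬Bx Bx)) , λ Cx → ¬B→C λ _ → Cx

  valuation : {M : Model n} (w : W M) → Σ (Vec Bool n) λ v → Realises v M w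
  valuation {M} w = tabulate b , λ p → subst (λ c → Lit c (V M p w)) (sym (lookup∘tabulate b p)) (Lit-does (dec (V M p w)))
    where
    b : Fin n → Bool
    b p = does (dec (V M p w))

  realisedMask : ∀ k {M : Model n} → Team M → Mask k
  realisedMask k {M} s = mask (λ τ → dec (Σ (W M) λ w → s w × HasType k τ M w)) (types k)

  mutual
    hasType : ∀ k {M : Model n} w → Σ (Type k) λ τ → τ ∈ types k × HasType k τ M w
    hasType zero {M} w = let (v , wv) = valuation {M} w in v , ∈-allVecs v , wv
    hasType (suc k) {M} w =
      let (v , wv) = valuation {M} w ; m = realisedMask k (R M w)
      in (v , m) , ∈-cartesianProduct⁺ (∈-allVecs v) (∈-allVecs m) , wv , hasTeamType k (R M w)

    hasTeamType : ∀ k {M : Model n} (s : Team M) → HasTeamType k (select (types k) (realisedMask k s)) M s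
    hasTeamType k {M} s =
      (λ w sw → let (τ , τ∈ , wτ) = hasType k w in lose (∈-select-mask⁺ realised? τ∈ (w , sw , wτ)) wτ) ,
      All.tabulate (∈-select-mask⁻ realised? (types k))
      where
      realised? = λ τ → dec (Σ (W M) λ w → s w × HasType k τ M w)

  module _ {M : Model n} where
    ⊨⁻-⋀⁺ : {A : Set} (f : A → Fm n g) (S : A → W M → Set) →
      (∀ x t → (∀ w → t w → S x w) → M , t ⊨⁻ f x) →
      ∀ xs s → (∀ w → s w → Any (λ x → S x w) xs) → M , s ⊨⁻ ⋀ (map f xs)
    ⊨⁻-⋀⁺ f S H xs s cover = ⊨⁻-⋀ f xs (⊨-⋁⁺ (neg ∘ f) S H xs s cover)

    ⊨⁻-lit : ∀ b p {s : Team M} → (∀ w → s w → ¬ Lit b (V M p w)) → M , s ⊨⁻ lit {g = g} b p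
    ⊨⁻-lit true p h = lift h
    ⊨⁻-lit false p h = lift λ w sw → dne (h w sw)

    ⊨⁻-lits : ∀ v {s : Team M} → (∀ w → s w → ¬ Realises v M w) → M , s ⊨⁻ lits {g = g} v
    ⊨⁻-lits v {s} h =
      ⊨⁻-⋀⁺ (λ p → lit (lookup v p) p) (λ p w → ¬ Lit (lookup v p) (V M p w)) (λ p t → ⊨⁻-lit (lookup v p) p)
        (allFin n) s
        λ w sw → let (p , ¬lit) = ¬∀⇒∃¬ (h w sw) in lose (∈-allFin p) ¬lit

    ⊨⁻-χ : ∀ k τ {s : Team M} → (∀ w → s w → ¬ HasType k τ M w) → M , s ⊨⁻ χ {g = g} k τ
    ⊨⁻-χ zero v h = ⊨⁻-lits v h
    ⊨⁻-χ (suc k) (v , m) {s} h =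
      ⊗-cover {P = ‖ neg (lits v) ‖} {Q = ‖ neg (⋀ (map (dia ∘ χ k) τs) ∧ᶠ □ (⋁ (map (χ k) τs))) ‖} {M = M}
        (λ w → ¬ Realises v M w) (λ w → ¬ HasTeamType k τs M (R M w))
        (λ w sw → ¬×⇒¬⊎¬ (h w sw)) (⊨⁻-lits v λ _ → proj₂)
        (⊗-cover {P = ‖ neg (⋀ (map (dia ∘ χ k) τs)) ‖} {Q = ‖ neg (□ (⋁ (map (χ k) τs))) ‖} {M = M}
          (λ w → ¬ All (λ τ → Σ (W M) λ u → R M w u × HasType k τ M u) τs)
          (λ w → ¬ (∀ u → R M w u → Any (λ τ → HasType k τ M u) τs))
          (λ w (_ , ¬T) → Sum.swap (¬×⇒¬⊎¬ ¬T)) (missingSuccessor λ _ → proj₂) (untypedSuccessor λ _ → proj₂))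
      where
      τs = select (types k) m
      missingSuccessor : ∀ {t} → (∀ w → t w → ¬ All (λ τ → Σ (W M) λ u → R M w u × HasType k τ M u) τs) →
        M , t ⊨⁻ ⋀ (map (dia ∘ χ {g = g} k) τs)
      missingSuccessor {t = t} h′ =
        ⊨⁻-⋀⁺ (dia ∘ χ k) (λ τ w → ¬ Σ (W M) λ u → R M w u × HasType k τ M u)
          (λ τ t′ none w t′w → ⊨⁻-χ k τ λ u Rwu uτ → none w t′w (u , Rwu , uτ)) τs t
          (λ w tw → ¬All⇒Any¬ (λ τ → dec _) τs (h′ w tw))
      untypedSuccessor : ∀ {t} → (∀ w → t w → ¬ (∀ u → R M w u → Any (λ τ → HasType k τ M u) τs)) →
        M , t ⊨⁻ □ (⋁ (map (χ {g = g} k) τs))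
      untypedSuccessor h′ w tw =
        let (u , Rwu , untyped) = ¬∀→⇒∃×¬ (h′ w tw)
        in ⊨-singleton-◇ {M = M} {φ = neg (⋁ (map (χ k) τs))} Rwu
             (⊨⁻-⋁⁺ (χ k) τs (All.tabulate λ {τ} τ∈ →
               ⊨⁻-χ k τ λ { _ refl uτ → untyped (lose τ∈ uτ) }))

    ∅⊨⁻-χ : ∀ k τ → M , ∅ᵗ ⊨⁻ χ {g = g} k τ
    ∅⊨⁻-χ k τ = ⊨⁻-χ k τ λ _ ()

    ∅⊨⁻-θ : ∀ k τs → M , ∅ᵗ ⊨⁻ θ {g = g} k τs
    ∅⊨⁻-θ k τs =
      ⊨⁻-∧-emptyˡ {M = M} {φ = ⋁ (map (χ k) τs)} {ψ = ⋀ (map (contains ∘ χ k) τs)}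
        (⊨⁻-⋁⁺ (χ k) τs (All.tabulate λ _ → ∅⊨⁻-χ k _))
        (∅⊨⁻-⋀ (contains ∘ χ k) τs (All.tabulate λ _ → ∅⊨⁻-contains {M = M} {φ = χ k _} (∅⊨⁻-χ k _)))

  Occurs : Property n → ∀ k → Type k → Set₁
  Occurs P k τ = Σ (Model n) λ N → Σ (Team N) λ p → Σ (W N) λ x → P N p × p x × HasType k τ N x

  Occurs⇒NearGround : ∀ {P k τ} {M : Model n} {w} → Occurs P k τ → HasType k τ M w → NearGround k P M w
  Occurs⇒NearGround {k = k} {τ} (N , p , x , Pp , px , xτ) wτ =
    record { model = N ; team = p ; point = x ; P-team = Pp ; point∈team = px ; point≈w = HasType⇒Bisim k τ xτ wτ }

  γ : Property n → ℕ → Fm n g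
  γ P k = ⋁ (map (χ k) (filter (λ τ → em {Occurs P k τ}) (types k)))

  module _ {P : Property n} {k : ℕ} {M : Model n} where
    γ⁺ : {s : Team M} → P M s → M , s ⊨ γ {g = g} P k
    γ⁺ {s = s} Ps = ⊨-⋁⁺ (χ k) (λ τ → HasType k τ M) (λ τ t → χ⁺ k τ) _ s λ w sw →
      let (τ , τ∈ , wτ) = hasType k w in lose (∈-filter⁺ (λ τ → em) τ∈ (M , s , w , Ps , sw , wτ)) wτ

    γ⁻ : {s : Team M} → M , s ⊨ γ {g = g} P k → ∀ w → s w → NearGround k P M w
    γ⁻ {s = s} h w sw =
      let (τ , τ∈ , wτ) = find (⊨-⋁⁻ (χ k) (λ τ → HasType k τ M) (λ τ t → χ⁻ k τ) _ s h w sw)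
      in Occurs⇒NearGround (proj₂ (∈-filter⁻ (λ τ → em) {xs = types k} τ∈)) wτ

    ⊨⁻-γ : {s : Team M} → (∀ w → s w → ¬ NearGround k P M w) → M , s ⊨⁻ γ {g = g} P k
    ⊨⁻-γ far = ⊨⁻-⋁⁺ (χ k) _ (All.tabulate λ τ∈ → ⊨⁻-χ k _ λ w sw wτ →
      far w sw (Occurs⇒NearGround (proj₂ (∈-filter⁻ (λ τ → em) {xs = types k} τ∈)) wτ))

  separator : ∀ {k l} {P Q : Property n} → GroundIncompatible P Q → Invariant k P → Invariant l Q → Separator g P Q
  separator {k = k} {Q = Q} gi invP invQ =
    γ Q k , (λ M s → γ⁺ {P = Q} {k = k}) ,
    λ M p Pp → ⊨⁻-γ λ w pw → GroundIncompatible⇒¬NearGround gi invP invQ Pp pw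

  module InvariantNormalForm {P : Property n} {k : ℕ} (invP : Invariant k P) where
    Realisable : Mask k → Set₁
    Realisable m = Σ (Model n) λ M → Σ (Team M) λ s → P M s × HasTeamType k (select (types k) m) M s

    realisable : List (Mask k)
    realisable = filter (λ m → em {Realisable m}) (allVecs (length (types k)))

    α : BSMLI n
    α = ⩖ (θ k ∘ select (types k)) realisable

    α⁺ : ∀ M s → P M s → M , s ⊨ α
    α⁺ M s Ps =
      ⊨-⩖⁺ (θ k ∘ select (types k))
        (lose (∈-filter⁺ (λ m → em) (∈-allVecs (realisedMask k s)) (M , s , Ps , hasTeamType k s))
          (θ⁺ k _ (hasTeamType k s)))

    α⁻ : ∀ M s → M , s ⊨ α → P M s
    α⁻ M s h =
      let (m , m∈ , s⊨θ) = find (⊨-⩖⁻ (θ k ∘ select (types k)) realisable h)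
          (M' , s' , Ps' , s'-type) = proj₂ (∈-filter⁻ (λ m → em) {xs = allVecs (length (types k))} m∈)
      in invP M' M s' s (HasTeamType⇒TeamBisim k _ s'-type (θ⁻ k _ s⊨θ)) Ps'

    normalForm : NormalForm true P
    normalForm =
      α , (λ M s → α⁻ M s , α⁺ M s) ,
      λ M → ⊨⁻-⩖ (θ k ∘ select (types k)) realisable (All.tabulate λ {m} _ → ∅⊨⁻-θ {M = M} k (select (types k) m))

  module ConvexNormalForm {g : Bool} {P : Property n} {k : ℕ}
    (cvP : Convex P) (ucP : UnionClosed P) (invP : Invariant k P) where
    Fits : Mask k → Set₁
    Fits m = Σ (Model n) λ M → Σ (Team M) λ s →
      P M s × (∀ w → s w → Any (λ τ → HasType k τ M w) (select (types k) m))

    misfits : List (Mask k)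
    misfits = filter (λ m → em {¬ Fits m}) (allVecs (length (types k)))

    escapes : Mask k → Fm n g
    escapes m = contains (⋁ (map (χ k) (reject (types k) m)))

    α : Fm n g
    α = γ P k ∧ᶠ ⋀ (map escapes misfits)

    escapes⁺ : ∀ {M} {s : Team M} m → P M s → ¬ Fits m → M , s ⊨ escapes m
    escapes⁺ {M} {s} m Ps misfit =
      let (w , sw , untyped) = ¬∀→⇒∃×¬ λ fits → misfit (M , s , Ps , fits)
          (τ , τ∈ , wτ) = hasType k w
      in [ (λ τ∈sel → ⊥-elim (untyped (lose τ∈sel wτ))) ,
           (λ τ∈rej → contains⁺ {M = M} {t = _≡ w} {φ = ⋁ (map (χ k) (reject (types k) m))}
             (λ { _ refl → sw }) (w , refl)
             (⊨-⋁⁺ (χ k) (λ τ → HasType k τ M) (λ τ t → χ⁺ k τ) (reject (types k) m) (_≡ w)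
               λ { _ refl → lose τ∈rej wτ })) ]′
         (∈-select⊎reject m τ∈)

    α⁺ : ∀ M s → P M s → M , s ⊨ α
    α⁺ M s Ps = γ⁺ {P = P} {k = k} Ps , ⊨-⋀⁺ escapes misfits
      (All.tabulate λ {m} m∈ → escapes⁺ m Ps (proj₂ (∈-filter⁻ (λ m → em) {xs = allVecs (length (types k))} m∈)))

    -- If the mask of the types realised in s were a misfit, s would have to escape it, which is absurd.
    realisedMask-fits : ∀ {M} {s : Team M} → M , s ⊨ ⋀ (map escapes misfits) → Fits (realisedMask k s)
    realisedMask-fits {M} {s} s⊨escapes = dne₁ λ misfit →
      let m = realisedMask k s
          m-escape = All.lookup (⊨-⋀⁻ escapes misfits s⊨escapes) (∈-filter⁺ (λ m → em) (∈-allVecs m) misfit)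
          (t , t⊆s , (x , tx) , t⊨⋁) = contains⁻ {M = M} {φ = ⋁ (map (χ k) (reject (types k) m))} m-escape
          (τ , τ∈ , xτ) = find (⊨-⋁⁻ (χ k) (λ τ → HasType k τ M) (λ τ t → χ⁻ k τ) _ t t⊨⋁ x tx)
      in ∈-reject-mask⁻ (λ τ → dec _) (types k) τ∈ (x , t⊆s x tx , xτ)

    α⁻ : ∀ M s → M , s ⊨ α → P M s
    α⁻ M s (s⊨γ , s⊨escapes) =
      let (M' , s' , Ps' , s'-types) = realisedMask-fits s⊨escapes
      in sandwiched cvP ucP invP Ps'
           (λ y s'y → let (τ , τ∈ , yτ) = find (s'-types y s'y)
                          (w , sw , wτ) = ∈-select-mask⁻ (λ τ → dec _) (types k) τ∈
                      in w , sw , HasType⇒Bisim k τ yτ wτ)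
           (γ⁻ s⊨γ)

    normalForm : NormalForm g P
    normalForm =
      α , (λ M s → α⁻ M s , α⁺ M s) ,
      λ M → ⊨⁻-∧-emptyˡ {M = M} {φ = γ P k} {ψ = ⋀ (map escapes misfits)} (⊨⁻-γ {P = P} {k = k} λ _ ())
              (∅⊨⁻-⋀ escapes misfits (All.tabulate λ {m} _ →
                 ∅⊨⁻-contains {M = M} {φ = ⋁ (map (χ k) (reject (types k) m))}
                   (⊨⁻-⋁⁺ (χ k) (reject (types k) m) (All.tabulate λ _ → ∅⊨⁻-χ k _))))

≐-refl : {P : Property n} → P ≐ P
≐-refl M s = id , id

≐-sym : {P Q : Property n} → P ≐ Q → Q ≐ P
≐-sym P≐Q M s = swap (P≐Q M s)

module _ {P Q : Property n} (P≐Q : P ≐ Q) where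
  Convex-≐ : Convex P → Convex Q
  Convex-≐ cvP M s t u Qs Qu s⊆t t⊆u =
    proj₁ (P≐Q M t) (cvP M s t u (proj₂ (P≐Q M s) Qs) (proj₂ (P≐Q M u) Qu) s⊆t t⊆u)

  UnionClosed-≐ : UnionClosed P → UnionClosed Q
  UnionClosed-≐ ucP M I i₀ f Qf = proj₁ (P≐Q M _) (ucP M I i₀ f λ i → proj₂ (P≐Q M (f i)) (Qf i))

  BBInvariant-≐ : BBInvariant P → BBInvariant Q
  BBInvariant-≐ (k , invP) = k , λ M M' s s' bis Qs → proj₁ (P≐Q M' s') (invP M M' s s' bis (proj₂ (P≐Q M s) Qs))

ClassBSML-‖‖ : (φ : BSML n) → ClassBSML n ‖ φ ‖ ‖ neg φ ‖
ClassBSML-‖‖ φ =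
  ‖‖-convex φ , ‖‖-unionClosed φ , ‖‖-bbInvariant φ ,
  ‖¬‖-convex φ , ‖¬‖-unionClosed φ , ‖‖-bbInvariant (neg φ) , ‖‖-groundIncompatible φ

ClassBSMLI-‖‖ : (φ : BSMLI n) → ClassBSMLI n ‖ φ ‖ ‖ neg φ ‖
ClassBSMLI-‖‖ φ = ‖‖-bbInvariant φ , ‖‖-bbInvariant (neg φ) , ‖‖-groundIncompatible φ

ClassGI-expressible-‖‖ : (φ : Fm n g) →
  ClassGI n (‖ φ ‖) (‖ neg φ ‖) × Expressible g n (‖ φ ‖) × Expressible g n (‖ neg φ ‖)
ClassGI-expressible-‖‖ φ = ‖‖-groundIncompatible φ , (φ , ≐-refl) , (neg φ , ≐-refl)

ClassBSML-expressible : {P Q : Property n} →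
  ClassGI n P Q × Expressible false n P × Expressible false n Q → ClassBSML n P Q
ClassBSML-expressible (gi , (φ , P≐φ) , (ψ , Q≐ψ)) =
  Convex-≐ (≐-sym P≐φ) (‖‖-convex φ) , UnionClosed-≐ (≐-sym P≐φ) (‖‖-unionClosed φ) ,
  BBInvariant-≐ (≐-sym P≐φ) (‖‖-bbInvariant φ) ,
  Convex-≐ (≐-sym Q≐ψ) (‖‖-convex ψ) , UnionClosed-≐ (≐-sym Q≐ψ) (‖‖-unionClosed ψ) ,
  BBInvariant-≐ (≐-sym Q≐ψ) (‖‖-bbInvariant ψ) , gi

ClassBSMLI-expressible : {P Q : Property n} →
  ClassGI n P Q × Expressible true n P × Expressible true n Q → ClassBSMLI n P Q
ClassBSMLI-expressible (gi , (φ , P≐φ) , (ψ , Q≐ψ)) =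
  BBInvariant-≐ (≐-sym P≐φ) (‖‖-bbInvariant φ) , BBInvariant-≐ (≐-sym Q≐ψ) (‖‖-bbInvariant ψ) , gi

module _ (em : ExcludedMiddle (lsuc 0ℓ)) {n : ℕ} {P Q : Property n} where
  open Classical em n

  ClassBSML-complete : ClassBSML n P Q → Σ (BSML n) λ φ → (‖ φ ‖ ≐ P) × (‖ neg φ ‖ ≐ Q)
  ClassBSML-complete (cvP , ucP , (_ , invP) , cvQ , ucQ , (_ , invQ) , gi) =
    bicompletion (ConvexNormalForm.normalForm cvP ucP invP) (ConvexNormalForm.normalForm cvQ ucQ invQ)
      (separator gi invP invQ)

  ClassBSMLI-complete : ClassBSMLI n P Q → Σ (BSMLI n) λ φ → (‖ φ ‖ ≐ P) × (‖ neg φ ‖ ≐ Q)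
  ClassBSMLI-complete ((_ , invP) , (_ , invQ) , gi) =
    bicompletion (InvariantNormalForm.normalForm invP) (InvariantNormalForm.normalForm invQ) (separator gi invP invQ)

corollary2p20 : ExcludedMiddle (lsuc 0ℓ) →
    Bicomplete false ClassBSML
    × Bicomplete true ClassBSMLI
    × BicompleteModExpr false ClassGI
    × BicompleteModExpr true ClassGI
corollary2p20 em =
  (λ n → ClassBSML-‖‖ , λ P Q → ClassBSML-complete em) ,
  (λ n → ClassBSMLI-‖‖ , λ P Q → ClassBSMLI-complete em) ,
  (λ n → ClassGI-expressible-‖‖ , λ P Q → ClassBSML-complete em ∘ ClassBSML-expressible) ,
  (λ n → ClassGI-expressible-‖‖ , λ P Q → ClassBSMLI-complete em ∘ ClassBSMLI-expressible)
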